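{- There exist a constant $C>0$ and a family $(\varphi_n)_{n\in\mathbb{N}}$ of $\mathrm{GF}$-sentences such that each $\varphi_n$ contains neither constants nor equality, is over a signature $\sigma_n$ with $\mathrm{wd}(\sigma_n)=n+4$, satisfies $|\varphi_n|\le C\cdot n$, and is satisfiable, but only in domains of size at least $2^{n!}$.
   Context: First-order logic with relation and constant symbols, no function symbols. $\mathrm{GF}$ is the smallest set of formulas containing all atoms (including equality), closed under Boolean connectives, and such that if $\psi\in\mathrm{GF}$, $\bar x$ is a tuple of variables and $\gamma$ is an atom containing all variables of $\bar x$ and all free variables of $\psi$, then $\exists\bar x(\gamma\wedge\psi)$ and $\forall\bar x(\gamma\to\psi)$ are in $\mathrm{GF}$. The signature of a formula is the set of relation and constant symbols occurring in it; its width $\mathrm{wd}$ is the maximal arity of its relation symbols. $|\varphi|$ is the uniform length: each symbol occurrence counts $1$. -}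

module Defs where

open import Data.Nat using (ℕ; zero; suc; _+_; _*_; _⊔_; _≤_; _<_; _^_; _!)
open import Data.Bool using (Bool; T)
open import Data.List using (List; []; _∷_; _++_; length)
open import Data.List.Relation.Unary.All using (All)
open import Data.List.Membership.Propositional using (_∈_; _∉_)
open import Data.Vec using (Vec; []; _∷_)
open import Data.Product using (Σ; _×_; _,_)
open import Data.Sum using (_⊎_)
open import Data.Unit using (⊤)
open import Data.Empty using (⊥)
open import Relation.Nullary using (¬_)
open import Relation.Binary.PropositionalEquality using (_≡_)
open import Data.Nat using (_≟_)
open import Relation.Nullary using (yes; no)

-- Syntax of first-order logic with relation and constant symbols
-- (no function symbols).  Variables and constant symbols are named by ℕ.
-- A relation symbol is a pair (name, arity).

data Term : Set where
  var : ℕ → Term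
  con : ℕ → Term

data Atom : Set where
  rel : (R k : ℕ) → Vec Term k → Atom
  eq  : Term → Term → Atom

-- Formulas built from atoms by Boolean connectives and guarded
-- quantification  ∃x̄(γ ∧ ψ)  and  ∀x̄(γ → ψ)  (γ an atom).
-- Membership in GF additionally requires the guard condition, see IsGF.
data Fm : Set where
  atom : Atom → Fm
  neg  : Fm → Fm
  and  : Fm → Fm → Fm
  or   : Fm → Fm → Fm
  imp  : Fm → Fm → Fm
  gex  : List ℕ → Atom → Fm → Fm
  gall : List ℕ → Atom → Fm → Fm

tvars : Term → List ℕ
tvars (var x) = x ∷ []
tvars (con c) = []

tsvars : ∀ {k} → Vec Term k → List ℕ
tsvars [] = []
tsvars (t ∷ ts) = tvars t ++ tsvars ts

avars : Atom → List ℕ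
avars (rel R k ts) = tsvars ts
avars (eq s t) = tvars s ++ tvars t

Free : ℕ → Fm → Set
Free x (atom a) = x ∈ avars a
Free x (neg φ) = Free x φ
Free x (and φ ψ) = Free x φ ⊎ Free x ψ
Free x (or φ ψ) = Free x φ ⊎ Free x ψ
Free x (imp φ ψ) = Free x φ ⊎ Free x ψ
Free x (gex xs γ ψ) = x ∉ xs × (x ∈ avars γ ⊎ Free x ψ)
Free x (gall xs γ ψ) = x ∉ xs × (x ∈ avars γ ⊎ Free x ψ)

Sentence : Fm → Set
Sentence φ = ∀ x → ¬ Free x φ

IsGF : Fm → Set
IsGF (atom a) = ⊤
IsGF (neg φ) = IsGF φ
IsGF (and φ ψ) = IsGF φ × IsGF ψ
IsGF (or φ ψ) = IsGF φ × IsGF ψ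
IsGF (imp φ ψ) = IsGF φ × IsGF ψ
IsGF (gex xs γ ψ) =
  IsGF ψ × All (λ x → x ∈ avars γ) xs × (∀ x → Free x ψ → x ∈ avars γ)
IsGF (gall xs γ ψ) =
  IsGF ψ × All (λ x → x ∈ avars γ) xs × (∀ x → Free x ψ → x ∈ avars γ)

NoConstT : Term → Set
NoConstT (var x) = ⊤
NoConstT (con c) = ⊥

NoConstTs : ∀ {k} → Vec Term k → Set
NoConstTs [] = ⊤
NoConstTs (t ∷ ts) = NoConstT t × NoConstTs ts

NoConstA : Atom → Set
NoConstA (rel R k ts) = NoConstTs ts
NoConstA (eq s t) = NoConstT s × NoConstT t

NoConst : Fm → Set
NoConst (atom a) = NoConstA a
NoConst (neg φ) = NoConst φ
NoConst (and φ ψ) = NoConst φ × NoConst ψ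
NoConst (or φ ψ) = NoConst φ × NoConst ψ
NoConst (imp φ ψ) = NoConst φ × NoConst ψ
NoConst (gex xs γ ψ) = NoConstA γ × NoConst ψ
NoConst (gall xs γ ψ) = NoConstA γ × NoConst ψ

NoEqA : Atom → Set
NoEqA (rel R k ts) = ⊤
NoEqA (eq s t) = ⊥

NoEq : Fm → Set
NoEq (atom a) = NoEqA a
NoEq (neg φ) = NoEq φ
NoEq (and φ ψ) = NoEq φ × NoEq ψ
NoEq (or φ ψ) = NoEq φ × NoEq ψ
NoEq (imp φ ψ) = NoEq φ × NoEq ψ
NoEq (gex xs γ ψ) = NoEqA γ × NoEq ψ
NoEq (gall xs γ ψ) = NoEqA γ × NoEq ψ

-- width: maximal arity of a relation symbol occurring in φ
-- (= wd of the signature of φ; 0 if no relation symbol occurs)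
wdA : Atom → ℕ
wdA (rel R k ts) = k
wdA (eq s t) = 0

wd : Fm → ℕ
wd (atom a) = wdA a
wd (neg φ) = wd φ
wd (and φ ψ) = wd φ ⊔ wd ψ
wd (or φ ψ) = wd φ ⊔ wd ψ
wd (imp φ ψ) = wd φ ⊔ wd ψ
wd (gex xs γ ψ) = wdA γ ⊔ wd ψ
wd (gall xs γ ψ) = wdA γ ⊔ wd ψ

-- uniform length: every symbol occurrence counts 1
-- R(t₁..t_k) : 1 + k ;  s = t : 3 ;  ¬φ : 1 + |φ| ;  φ∘ψ : 1 + |φ| + |ψ| ;
-- ∃x̄(γ ∧ ψ), ∀x̄(γ → ψ) : 1 + |x̄| + |γ| + 1 + |ψ|
lenA : Atom → ℕ
lenA (rel R k ts) = suc k
lenA (eq s t) = 3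

len : Fm → ℕ
len (atom a) = lenA a
len (neg φ) = suc (len φ)
len (and φ ψ) = suc (len φ + len ψ)
len (or φ ψ) = suc (len φ + len ψ)
len (imp φ ψ) = suc (len φ + len ψ)
len (gex xs γ ψ) = suc (length xs + lenA γ + suc (len ψ))
len (gall xs γ ψ) = suc (length xs + lenA γ + suc (len ψ))

-- Semantics (Tarski).  Relations are Bool-valued, so on finite
-- domains satisfaction is the classical one.

record Structure (A : Set) : Set where
  field
    relI : (R k : ℕ) → Vec A k → Bool
    conI : ℕ → A
open Structure public

module _ {A : Set} (M : Structure A) where

  evalT : (ℕ → A) → Term → A
  evalT ρ (var x) = ρ x
  evalT ρ (con c) = conI M c

  evalTs : ∀ {k} → (ℕ → A) → Vec Term k → Vec A k
  evalTs ρ [] = []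
  evalTs ρ (t ∷ ts) = evalT ρ t ∷ evalTs ρ ts

  SatA : (ℕ → A) → Atom → Set
  SatA ρ (rel R k ts) = T (relI M R k (evalTs ρ ts))
  SatA ρ (eq s t) = evalT ρ s ≡ evalT ρ t

  update : (ℕ → A) → ℕ → A → ℕ → A
  update ρ x a y with y ≟ x
  ... | yes _ = a
  ... | no _ = ρ y

  extend : (ℕ → A) → (xs : List ℕ) → Vec A (length xs) → ℕ → A
  extend ρ [] [] = ρ
  extend ρ (x ∷ xs) (a ∷ as) = extend (update ρ x a) xs as

  Sat : (ℕ → A) → Fm → Set
  Sat ρ (atom a) = SatA ρ a
  Sat ρ (neg φ) = ¬ Sat ρ φ
  Sat ρ (and φ ψ) = Sat ρ φ × Sat ρ ψ
  Sat ρ (or φ ψ) = Sat ρ φ ⊎ Sat ρ ψ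
  Sat ρ (imp φ ψ) = Sat ρ φ → Sat ρ ψ
  Sat ρ (gex xs γ ψ) =
    Σ (Vec A (length xs)) λ as → SatA (extend ρ xs as) γ × Sat (extend ρ xs as) ψ
  Sat ρ (gall xs γ ψ) =
    (as : Vec A (length xs)) → SatA (extend ρ xs as) γ → Sat (extend ρ xs as) ψ

Satisfiable : Fm → Set₁
Satisfiable φ = Σ Set λ A → Σ (Structure A) λ M → Σ A λ a → Sat M (λ _ → a) φ

-- every model of φ has at least N elements.  Infinite models trivially
-- qualify, so it suffices to bound finite (non-empty) domains Fin (suc m).
open import Data.Fin using (Fin)
OnlyModelsOfSizeAtLeast : ℕ → Fm → Set
OnlyModelsOfSizeAtLeast N φ =
  ∀ m (M : Structure (Fin (suc m))) (ρ : ℕ → Fin (suc m)) → Sat M ρ φ → N ≤ suc m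

module Submission where

-- The tuples z̄ held by an element x (ARR x z̄) are closed under swapping the first two entries
-- and under rotation, hence under all rearrangements.  Each held z̄ has a successor y of x whose
-- order BEFORE x y is strict on the entries of z̄ and lists z̄ increasingly; strictness makes the
-- entries distinct and the increasing rearrangement unique, and the bit of y differs from that
-- of x exactly there.  Flipping bits one rearrangement at a time from a single holder realises
-- all 2 ^ (n + 2)! bit profiles on the (n + 2)! rearrangements, so every model is that large.
-- Conversely, nodes generated from a root by toggling at arrangements, with a node's bit at an
-- arrangement being the parity of its toggles there, form a model.

open import Defs

open import Data.Bool using (Bool; true; false; not; T; _∧_; _xor_)
open import Data.Bool.Properties using (¬-not; T?; T-∧) renaming (_≟_ to _≟ᵇ_)
open import Data.Empty using (⊥-elim)
open import Data.Fin using (Fin; zero; suc; quotient; remainder; combine; finToFun; funToFin)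
open import Data.Fin.Properties
  using (injective⇒≤; combine-remQuot; funToFin-finToFin; 2↔Bool) renaming (_≟_ to _≟ᶠ_)
open import Data.List as List using (List; []; _∷_; _++_; [_]; length)
open import Data.List.Membership.Propositional using (_∈_; _∉_)
open import Data.List.Membership.Propositional.Properties using (∈-∃++; ∈-++⁻; ∈-allFin)
open import Data.List.Properties using (++-assoc; ++-identityʳ; length-applyUpTo)
  renaming (∷-injective to ∷-injectiveˡ)
open import Data.List.Relation.Binary.Permutation.Propositional
  using (_↭_; prep; swap; ↭-refl; ↭-sym; ↭-trans; ↭-reflexive; ↭⇒↭ₛ)
  renaming (refl to ↭-refl′; trans to ↭-trans′)
open import Data.List.Relation.Binary.Permutation.Propositional.Properties
  using (shift; drop-∷; ∈-resp-↭; ↭-empty-inv; ++-comm)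
import Data.List.Relation.Binary.Permutation.Setoid.Properties as ↭ₛ
open import Data.List.Relation.Binary.Subset.Propositional using (_⊆_)
open import Data.List.Relation.Binary.Subset.Propositional.Properties
  using (⊆-reflexive; ⊆-reflexive-↭; ⊆-trans; xs⊆x∷xs; ∷⁺ʳ; ∈-∷⁺ʳ; xs⊆xs++ys)
open import Data.List.Relation.Unary.All as All using (All)
open import Data.List.Relation.Unary.All.Properties using (All¬⇒¬Any) renaming (map⁺ to All-map⁺)
open import Data.List.Relation.Unary.AllPairs using (AllPairs; []; _∷_)
open import Data.List.Relation.Unary.Any using (here; there)
open import Data.List.Relation.Unary.Linked using (Linked; []; [-]; _∷_; linked?)
open import Data.List.Relation.Unary.Unique.Propositional using (Unique)
open import Data.List.Relation.Unary.Unique.Propositional.Properties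
  using (upTo⁺) renaming (map⁺ to Unique-map⁺)
import Data.List.Relation.Unary.Unique.DecPropositional as UniqueDec
open import Data.Nat
  using (ℕ; zero; suc; pred; _+_; _*_; _!; _^_; _≤_; _<_; s≤s; z≤n; _≟_; _<ᵇ_)
open import Data.Nat.Properties
  using ( +-comm; m≤m+n; ≤-refl; ≤-reflexive; ≤-trans; ≤-antisym; n≤1+n; <-asym; <-trans
        ; <ᵇ⇒<; <⇒<ᵇ; ⊔-lub; m≤m⊔n; m≤n⊔m; ^-monoʳ-≤)
open import Data.Nat.Tactic.RingSolver using (solve; solve-∀)
open import Data.Product using (Σ; ∃-syntax; _×_; _,_; proj₁; proj₂)
open import Data.Sum using (inj₁; inj₂; [_,_]′)
open import Data.Unit using (tt)
open import Data.Vec as Vec using (Vec; []; _∷_; _∷ʳ_; toList; insertAt)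
open import Data.Vec.Properties
  using (toList∘fromList; toList-map; toList-∷ʳ; toList-injective; cast-is-id; ∷-injective; map-∷ʳ)
open import Function.Base using (_∘_; id)
open import Function.Bundles using (_↣_; mk↣; Injection; _⇔_; mk⇔; Equivalence)
open import Function.Definitions using (Injective)
open import Function.Properties.Equivalence using () renaming (refl to ⇔-refl; trans to ⇔-trans)
open import Function.Properties.Inverse using (↔⇒↣)
open import Relation.Binary.Definitions using (DecidableEquality)
open import Relation.Binary.PropositionalEquality
  using (_≡_; _≢_; _≗_; refl; sym; trans; cong; cong₂; subst; subst₂; module ≡-Reasoning)
open import Relation.Binary.PropositionalEquality.Properties using (setoid)
open import Relation.Nullary using (¬_; Dec; yes; no)
open import Relation.Nullary.Decidable
  using (map′; _×-dec_; ⌊_⌋; toWitness; fromWitness; isYes≗does; dec-true; dec-false)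

private variable
  A : Set
  n : ℕ

≡⇒⇔ : {P Q : Set} → P ≡ Q → P ⇔ Q
≡⇒⇔ refl = ⇔-refl

≡not⇔ : ∀ {b′ b} → b′ ≡ not b ⇔ ((T b′ → ¬ T b) × (¬ T b → T b′))
≡not⇔ {true} {false} = mk⇔ (λ _ → (λ _ ()) , (λ _ → tt)) (λ _ → refl)
≡not⇔ {false} {true} = mk⇔ (λ _ → (λ ()) , (λ ¬b → ¬b tt)) (λ _ → refl)
≡not⇔ {true} {true} = mk⇔ (λ ()) (λ (b′⇒¬b , _) → ⊥-elim (b′⇒¬b tt tt))
≡not⇔ {false} {false} = mk⇔ (λ ()) (λ (_ , ¬b⇒b′) → ⊥-elim (¬b⇒b′ λ ()))

≡⇔ : ∀ {b′ b} → b′ ≡ b ⇔ ((T b′ → T b) × (T b → T b′))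
≡⇔ {true} {true} = mk⇔ (λ _ → id , id) (λ _ → refl)
≡⇔ {false} {false} = mk⇔ (λ _ → id , id) (λ _ → refl)
≡⇔ {true} {false} = mk⇔ (λ ()) (λ (b′⇒b , _) → ⊥-elim (b′⇒b tt))
≡⇔ {false} {true} = mk⇔ (λ ()) (λ (_ , b⇒b′) → ⊥-elim (b⇒b′ tt))

↣⇒≤ : ∀ {m k} → Fin m ↣ Fin k → m ≤ k
↣⇒≤ f = injective⇒≤ (Injection.injective f)

n!≤[1+n]! : ∀ n → n ! ≤ suc n !
n!≤[1+n]! n = m≤m+n (n !) (n * n !)

affine≤ : ∀ a b k → a + b * k ≤ (a + b) * suc k
affine≤ a b k = ≤-trans (m≤m+n (a + b * k) (a * k + b)) (≤-reflexive (expand a b k))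
  where
  expand : ∀ a b k → a + b * k + (a * k + b) ≡ (a + b) * suc k
  expand = solve-∀

-- Rearranging vectors

toList-injective′ : {u v : Vec A n} → toList u ≡ toList v → u ≡ v
toList-injective′ {u = u} e = trans (sym (cast-is-id refl u)) (toList-injective refl u _ e)

∈⇒↭ : ∀ {x : A} {xs} → x ∈ xs → ∃[ r ] xs ↭ x ∷ r
∈⇒↭ {x = x} x∈xs with pre , suf , refl ← ∈-∃++ x∈xs = pre ++ suf , shift x pre suf

unique-↭ : ∀ {xs ys : List A} → xs ↭ ys → Unique xs → Unique ys
unique-↭ {A = A} p = ↭ₛ.Unique-resp-↭ (setoid A) (↭⇒↭ₛ p)

swap₀₁ : Vec A (suc (suc n)) → Vec A (suc (suc n))
swap₀₁ (a ∷ b ∷ v) = b ∷ a ∷ v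

rotate : Vec A (suc n) → Vec A (suc n)
rotate (a ∷ v) = v ∷ʳ a

module _ {B : Set} (f : A → B) where

  map-swap₀₁ : (v : Vec A (suc (suc n))) → Vec.map f (swap₀₁ v) ≡ swap₀₁ (Vec.map f v)
  map-swap₀₁ (a ∷ b ∷ v) = refl

  map-rotate : (v : Vec A (suc n)) → Vec.map f (rotate v) ≡ rotate (Vec.map f v)
  map-rotate (a ∷ v) = map-∷ʳ f a v

toList-swap₀₁-↭ : (v : Vec A (suc (suc n))) → toList (swap₀₁ v) ↭ toList v
toList-swap₀₁-↭ (a ∷ b ∷ v) = swap b a ↭-refl

toList-rotate-↭ : (v : Vec A (suc n)) → toList (rotate v) ↭ toList v
toList-rotate-↭ (a ∷ v) = ↭-trans (↭-reflexive (toList-∷ʳ a v)) (++-comm (toList v) [ a ])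

-- Swapping the first two entries and rotating generate all rearrangements:
-- rotations bring any adjacent pair to the front and back again.
module _ (P : Vec A (suc (suc n)) → Set)
         (P-swap : ∀ {v} → P v → P (swap₀₁ v))
         (P-rotate : ∀ {v} → P v → P (rotate v)) where

  private
    Listed : List A → Set
    Listed l = ∃[ v ] toList v ≡ l × P v

    listed-swap : ∀ {a b l} → Listed (a ∷ b ∷ l) → Listed (b ∷ a ∷ l)
    listed-swap (a ∷ b ∷ v , refl , p) = swap₀₁ (a ∷ b ∷ v) , refl , P-swap p

    listed-rotate : ∀ {a l} → Listed (a ∷ l) → Listed (l ++ [ a ])
    listed-rotate (a ∷ v , refl , p) = rotate (a ∷ v) , toList-∷ʳ a v , P-rotate p

    listed-rotation : ∀ pre suf → Listed (pre ++ suf) → Listed (suf ++ pre)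
    listed-rotation [] suf q = subst Listed (sym (++-identityʳ suf)) q
    listed-rotation (a ∷ pre) suf q =
      subst Listed (++-assoc suf [ a ] pre)
        (listed-rotation pre (suf ++ [ a ]) (subst Listed (++-assoc pre suf [ a ]) (listed-rotate q)))

    listed-swapAt : ∀ pre {a b} suf → Listed (pre ++ a ∷ b ∷ suf) → Listed (pre ++ b ∷ a ∷ suf)
    listed-swapAt pre {a} {b} suf q =
      listed-rotation (b ∷ a ∷ suf) pre (listed-swap (listed-rotation pre (a ∷ b ∷ suf) q))

    listed-↭ : ∀ pre {xs ys} → xs ↭ ys → Listed (pre ++ xs) → Listed (pre ++ ys)
    listed-↭ pre ↭-refl′ q = q
    listed-↭ pre (prep x p) q =
      subst Listed (++-assoc pre [ x ] _)
        (listed-↭ (pre ++ [ x ]) p (subst Listed (sym (++-assoc pre [ x ] _)) q))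
    listed-↭ pre (swap x y p) q =
      subst Listed (++-assoc pre (y ∷ x ∷ []) _)
        (listed-↭ (pre ++ y ∷ x ∷ []) p
          (subst Listed (sym (++-assoc pre (y ∷ x ∷ []) _)) (listed-swapAt pre _ q)))
    listed-↭ pre (↭-trans′ p p′) q = listed-↭ pre p′ (listed-↭ pre p q)

  realise-↭ : ∀ {u l} → P u → toList u ↭ l → ∃[ v ] toList v ≡ l × P v
  realise-↭ {u} pu p = listed-↭ [] p (u , refl , pu)

  resp-↭ : ∀ {u w} → P u → toList u ↭ toList w → P w
  resp-↭ pu p with v , v≡w , pv ← realise-↭ pu p = subst P (toList-injective′ v≡w) pv

-- Strict orders on the positions of a list

-- Only distinct positions of X are constrained, so X may a priori contain repetitions.
module _ {A : Set} (_≺_ : A → A → Set) where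

  AsymmetricOn : List A → Set
  AsymmetricOn X = ∀ {a b r} → a ∷ b ∷ r ↭ X → ¬ (a ≺ b × b ≺ a)

  TransitiveOn : List A → Set
  TransitiveOn X = ∀ {a b c r} → a ∷ b ∷ c ∷ r ↭ X → a ≺ b → b ≺ c → a ≺ c

  asymmetricOn-∷ : ∀ {x X} → AsymmetricOn (x ∷ X) → AsymmetricOn X
  asymmetricOn-∷ {x} asym {a} {b} {r} p = asym (↭-trans (shift x (a ∷ b ∷ []) r) (prep x p))

  transitiveOn-∷ : ∀ {x X} → TransitiveOn (x ∷ X) → TransitiveOn X
  transitiveOn-∷ {x} trans′ {a} {b} {c} {r} p = trans′ (↭-trans (shift x (a ∷ b ∷ c ∷ []) r) (prep x p))

  linked⇒allPairs : ∀ {u} → TransitiveOn u → Linked _≺_ u → AllPairs _≺_ u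
  linked⇒allPairs _ [] = []
  linked⇒allPairs _ [-] = All.[] ∷ []
  linked⇒allPairs {a ∷ b ∷ l} trans′ (a≺b ∷ linked)
    with b≺l ∷ sorted ← linked⇒allPairs (transitiveOn-∷ trans′) linked =
    (a≺b All.∷ All.tabulate a≺c) ∷ b≺l ∷ sorted
    where
    a≺c : ∀ {c} → c ∈ l → a ≺ c
    a≺c c∈l with r , l↭ ← ∈⇒↭ c∈l = trans′ (prep a (prep b (↭-sym l↭))) a≺b (All.lookup b≺l c∈l)

  allPairs⇒unique : ∀ {u} → AsymmetricOn u → AllPairs _≺_ u → Unique u
  allPairs⇒unique _ [] = []
  allPairs⇒unique {a ∷ u} asym (a≺u ∷ sorted) =
    All.tabulate a≢x ∷ allPairs⇒unique (asymmetricOn-∷ asym) sorted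
    where
    a≢x : ∀ {x} → x ∈ u → a ≢ x
    a≢x x∈u refl with r , u↭ ← ∈⇒↭ x∈u =
      asym (prep a (↭-sym u↭)) (All.lookup a≺u x∈u , All.lookup a≺u x∈u)

  allPairs-↭⇒≡ : ∀ {u w} → AsymmetricOn u → u ↭ w → AllPairs _≺_ u → AllPairs _≺_ w → u ≡ w
  allPairs-↭⇒≡ {[]} _ p _ _ = sym (↭-empty-inv (↭-sym p))
  allPairs-↭⇒≡ {_ ∷ _} {[]} _ p _ _ with () ← ↭-empty-inv p
  allPairs-↭⇒≡ {a ∷ u} {b ∷ w} asym p (a≺u ∷ su) (b≺w ∷ sw)
    with ∈-resp-↭ (↭-sym p) (here refl) | ∈-resp-↭ p (here refl)
  ... | here refl | _ = cong (a ∷_) (allPairs-↭⇒≡ (asymmetricOn-∷ asym) (drop-∷ p) su sw)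
  ... | there _ | here refl = cong (a ∷_) (allPairs-↭⇒≡ (asymmetricOn-∷ asym) (drop-∷ p) su sw)
  ... | there b∈u | there a∈w with r , u↭ ← ∈⇒↭ b∈u =
    ⊥-elim (asym (prep a (↭-sym u↭)) (All.lookup a≺u b∈u , All.lookup b≺w a∈w))

-- Enumerating the arrangements of a vector

insertAt-↭ : ∀ (v : Vec A n) i x → toList (insertAt v i x) ↭ x ∷ toList v
insertAt-↭ v zero x = ↭-refl
insertAt-↭ (y ∷ v) (suc i) x = ↭-trans (prep y (insertAt-↭ v i x)) (swap y x ↭-refl)

insertAt-injective : ∀ {x} (u w : Vec A n) i j → x ∉ toList u → x ∉ toList w →
                     insertAt u i x ≡ insertAt w j x → i ≡ j × u ≡ w
insertAt-injective u w zero zero _ _ refl = refl , refl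
insertAt-injective u (y ∷ w) zero (suc j) _ x∉w e = ⊥-elim (x∉w (here (proj₁ (∷-injective e))))
insertAt-injective (y ∷ u) w (suc i) zero x∉u _ e = ⊥-elim (x∉u (here (sym (proj₁ (∷-injective e)))))
insertAt-injective (y ∷ u) (y′ ∷ w) (suc i) (suc j) x∉u x∉w e
  with refl , e′ ← ∷-injective e
  with refl , refl ← insertAt-injective u w i j (x∉u ∘ there) (x∉w ∘ there) e′ = refl , refl

arrangements : Vec A n → Fin (n !) → Vec A n
arrangements [] _ = []
arrangements {n = suc n} (x ∷ v) c =
  insertAt (arrangements v (remainder {suc n} (n !) c)) (quotient (n !) c) x

arrangements-↭ : ∀ (v : Vec A n) c → toList (arrangements v c) ↭ toList v
arrangements-↭ [] _ = ↭-refl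
arrangements-↭ (x ∷ v) c = ↭-trans (insertAt-↭ _ _ x) (prep x (arrangements-↭ v _))

∉-arrangements : ∀ {x} (v : Vec A n) → x ∉ toList v → ∀ c → x ∉ toList (arrangements v c)
∉-arrangements v x∉v c x∈ = x∉v (∈-resp-↭ (arrangements-↭ v c) x∈)

arrangements-injective : ∀ (v : Vec A n) → Unique (toList v) → Injective _≡_ _≡_ (arrangements v)
arrangements-injective [] _ {zero} {zero} _ = refl
arrangements-injective {n = suc n} (x ∷ v) (x≢v ∷ unique) {c} {c′} e
  with q≡q′ , e′ ← insertAt-injective _ _ _ _ (∉-arrangements v (All¬⇒¬Any x≢v) _)
                                              (∉-arrangements v (All¬⇒¬Any x≢v) _) e =
  begin
    c                                                         ≡⟨ combine-remQuot {suc n} (n !) c ⟨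
    combine (quotient (n !) c) (remainder {suc n} (n !) c)    ≡⟨ cong₂ combine q≡q′ (arrangements-injective v unique e′) ⟩
    combine (quotient (n !) c′) (remainder {suc n} (n !) c′)  ≡⟨ combine-remQuot {suc n} (n !) c′ ⟩
    c′                                                        ∎
  where open ≡-Reasoning

-- Realising bit profiles

funToFin-cong : ∀ {m k} {f g : Fin m → Fin k} → f ≗ g → funToFin f ≡ funToFin g
funToFin-cong {zero} _ = refl
funToFin-cong {suc m} f≗g = cong₂ combine (f≗g zero) (funToFin-cong (f≗g ∘ suc))

finToFun-injective : ∀ {m k} {x y : Fin (k ^ m)} → finToFun {k} {m} x ≗ finToFun y → x ≡ y
finToFun-injective {m} {k} {x} {y} e =
  trans (sym (funToFin-finToFin {m} {k} x)) (trans (funToFin-cong e) (funToFin-finToFin {m} {k} y))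

module _ {D : Set} {N : ℕ} (profile : D → Fin N → Bool) (Good : D → Set) where

  FlipsEachBit : Set
  FlipsEachBit = ∀ {d} → Good d → ∀ c →
    ∃[ d′ ] Good d′ × profile d′ c ≡ not (profile d c) × (∀ {c′} → c′ ≢ c → profile d′ c′ ≡ profile d c′)

  module _ (flips : FlipsEachBit) {d₀} (good₀ : Good d₀) where

    realiseOn : (t : Fin N → Bool) (cs : List (Fin N)) → ∃[ d ] Good d × (∀ {c} → c ∈ cs → profile d c ≡ t c)
    realiseOn t [] = d₀ , good₀ , λ ()
    realiseOn t (c ∷ cs) with d , good , agree ← realiseOn t cs | profile d c ≟ᵇ t c
    ... | yes same = d , good , λ { (here refl) → same ; (there c′∈cs) → agree c′∈cs }
    ... | no differ with d′ , good′ , flipped , kept ← flips good c = d′ , good′ , agree′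
      where
      fixed : profile d′ c ≡ t c
      fixed = trans flipped (sym (¬-not (differ ∘ sym)))

      agree′ : ∀ {c′} → c′ ∈ c ∷ cs → profile d′ c′ ≡ t c′
      agree′ (here refl) = fixed
      agree′ {c′} (there c′∈cs) with c′ ≟ᶠ c
      ... | yes refl = fixed
      ... | no c′≢c = trans (kept c′≢c) (agree c′∈cs)

    realise : (t : Fin N → Bool) → ∃[ d ] (∀ c → profile d c ≡ t c)
    realise t with d , _ , agree ← realiseOn t (List.allFin N) = d , λ c → agree (∈-allFin c)

    private
      bits : Fin (2 ^ N) → Fin N → Bool
      bits x = Injection.to (↔⇒↣ 2↔Bool) ∘ finToFun {2} {N} x

      realiseBits : Fin (2 ^ N) → D
      realiseBits x = proj₁ (realise (bits x))

      realiseBits-injective : Injective _≡_ _≡_ realiseBits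
      realiseBits-injective {x} {y} e = finToFun-injective {N} {2} λ c →
        Injection.injective (↔⇒↣ 2↔Bool) (begin
          bits x c                   ≡⟨ proj₂ (realise (bits x)) c ⟨
          profile (realiseBits x) c  ≡⟨ cong (λ d → profile d c) e ⟩
          profile (realiseBits y) c  ≡⟨ proj₂ (realise (bits y)) c ⟩
          bits y c                   ∎)
        where open ≡-Reasoning

    profiles-↣ : Fin (2 ^ N) ↣ D
    profiles-↣ = mk↣ realiseBits-injective

-- Relational guarded formulas

_⟨_⟩ : ℕ → Vec ℕ n → Atom
R ⟨ ws ⟩ = rel R _ (Vec.map var ws)

avars-⟨⟩ : ∀ R (ws : Vec ℕ n) → avars (R ⟨ ws ⟩) ≡ toList ws
avars-⟨⟩ R [] = refl
avars-⟨⟩ R (w ∷ ws) = cong (w ∷_) (avars-⟨⟩ R ws)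

noConst-vars : ∀ (ws : Vec ℕ n) → NoConstTs (Vec.map var ws)
noConst-vars [] = tt
noConst-vars (w ∷ ws) = tt , noConst-vars ws

Plain : ℕ → Atom → Set
Plain b a = NoConstA a × NoEqA a × wdA a ≤ b

record RelAtom (b : ℕ) (S : List ℕ) (a : Atom) : Set where
  constructor relAtom
  field
    plain : Plain b a
    scoped : avars a ⊆ S

record Guard (b : ℕ) (S xs : List ℕ) (γ : Atom) : Set where
  constructor guard
  field
    plain : Plain b γ
    binds : xs ⊆ avars γ
    scoped : avars γ ⊆ xs ++ S

-- Below a guarded quantifier, the admissible free variables S become those of the guard.
RelGF : ℕ → List ℕ → Fm → Set
RelGF b S (atom a) = RelAtom b S a
RelGF b S (neg φ) = RelGF b S φ
RelGF b S (and φ ψ) = RelGF b S φ × RelGF b S ψ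
RelGF b S (or φ ψ) = RelGF b S φ × RelGF b S ψ
RelGF b S (imp φ ψ) = RelGF b S φ × RelGF b S ψ
RelGF b S (gex xs γ ψ) = Guard b S xs γ × RelGF b (avars γ) ψ
RelGF b S (gall xs γ ψ) = Guard b S xs γ × RelGF b (avars γ) ψ

∈-unbound : ∀ {S γ x} xs → avars γ ⊆ xs ++ S → x ∉ xs → x ∈ avars γ → x ∈ S
∈-unbound xs γ⊆ x∉xs x∈γ with ∈-++⁻ xs (γ⊆ x∈γ)
... | inj₁ x∈xs = ⊥-elim (x∉xs x∈xs)
... | inj₂ x∈S = x∈S

module _ {b : ℕ} where

  relGF-free : ∀ {S} φ → RelGF b S φ → ∀ {x} → Free x φ → x ∈ S
  relGF-free (atom a) (relAtom _ a⊆S) x∈a = a⊆S x∈a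
  relGF-free (neg φ) h = relGF-free φ h
  relGF-free (and φ ψ) (h , _) (inj₁ x∈φ) = relGF-free φ h x∈φ
  relGF-free (and φ ψ) (_ , h) (inj₂ x∈ψ) = relGF-free ψ h x∈ψ
  relGF-free (or φ ψ) (h , _) (inj₁ x∈φ) = relGF-free φ h x∈φ
  relGF-free (or φ ψ) (_ , h) (inj₂ x∈ψ) = relGF-free ψ h x∈ψ
  relGF-free (imp φ ψ) (h , _) (inj₁ x∈φ) = relGF-free φ h x∈φ
  relGF-free (imp φ ψ) (_ , h) (inj₂ x∈ψ) = relGF-free ψ h x∈ψ
  relGF-free (gex xs γ ψ) (guard _ _ γ⊆ , h) (x∉xs , x∈) =
    ∈-unbound {γ = γ} xs γ⊆ x∉xs ([ id , relGF-free ψ h ]′ x∈)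
  relGF-free (gall xs γ ψ) (guard _ _ γ⊆ , h) (x∉xs , x∈) =
    ∈-unbound {γ = γ} xs γ⊆ x∉xs ([ id , relGF-free ψ h ]′ x∈)

  relGF⇒sentence : ∀ φ → RelGF b [] φ → Sentence φ
  relGF⇒sentence φ h x x∈φ with () ← relGF-free φ h x∈φ

  relGF⇒isGF : ∀ {S} φ → RelGF b S φ → IsGF φ
  relGF⇒isGF (atom a) _ = tt
  relGF⇒isGF (neg φ) h = relGF⇒isGF φ h
  relGF⇒isGF (and φ ψ) (h , g) = relGF⇒isGF φ h , relGF⇒isGF ψ g
  relGF⇒isGF (or φ ψ) (h , g) = relGF⇒isGF φ h , relGF⇒isGF ψ g
  relGF⇒isGF (imp φ ψ) (h , g) = relGF⇒isGF φ h , relGF⇒isGF ψ g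
  relGF⇒isGF (gex xs γ ψ) (guard _ xs⊆ _ , h) =
    relGF⇒isGF ψ h , All.tabulate xs⊆ , λ _ → relGF-free ψ h
  relGF⇒isGF (gall xs γ ψ) (guard _ xs⊆ _ , h) =
    relGF⇒isGF ψ h , All.tabulate xs⊆ , λ _ → relGF-free ψ h

  relGF⇒noConst : ∀ {S} φ → RelGF b S φ → NoConst φ
  relGF⇒noConst (atom a) (relAtom (c , _) _) = c
  relGF⇒noConst (neg φ) h = relGF⇒noConst φ h
  relGF⇒noConst (and φ ψ) (h , g) = relGF⇒noConst φ h , relGF⇒noConst ψ g
  relGF⇒noConst (or φ ψ) (h , g) = relGF⇒noConst φ h , relGF⇒noConst ψ g
  relGF⇒noConst (imp φ ψ) (h , g) = relGF⇒noConst φ h , relGF⇒noConst ψ g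
  relGF⇒noConst (gex xs γ ψ) (guard (c , _) _ _ , h) = c , relGF⇒noConst ψ h
  relGF⇒noConst (gall xs γ ψ) (guard (c , _) _ _ , h) = c , relGF⇒noConst ψ h

  relGF⇒noEq : ∀ {S} φ → RelGF b S φ → NoEq φ
  relGF⇒noEq (atom a) (relAtom (_ , e , _) _) = e
  relGF⇒noEq (neg φ) h = relGF⇒noEq φ h
  relGF⇒noEq (and φ ψ) (h , g) = relGF⇒noEq φ h , relGF⇒noEq ψ g
  relGF⇒noEq (or φ ψ) (h , g) = relGF⇒noEq φ h , relGF⇒noEq ψ g
  relGF⇒noEq (imp φ ψ) (h , g) = relGF⇒noEq φ h , relGF⇒noEq ψ g
  relGF⇒noEq (gex xs γ ψ) (guard (_ , e , _) _ _ , h) = e , relGF⇒noEq ψ h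
  relGF⇒noEq (gall xs γ ψ) (guard (_ , e , _) _ _ , h) = e , relGF⇒noEq ψ h

  relGF⇒wd≤ : ∀ {S} φ → RelGF b S φ → wd φ ≤ b
  relGF⇒wd≤ (atom a) (relAtom (_ , _ , w) _) = w
  relGF⇒wd≤ (neg φ) h = relGF⇒wd≤ φ h
  relGF⇒wd≤ (and φ ψ) (h , g) = ⊔-lub (relGF⇒wd≤ φ h) (relGF⇒wd≤ ψ g)
  relGF⇒wd≤ (or φ ψ) (h , g) = ⊔-lub (relGF⇒wd≤ φ h) (relGF⇒wd≤ ψ g)
  relGF⇒wd≤ (imp φ ψ) (h , g) = ⊔-lub (relGF⇒wd≤ φ h) (relGF⇒wd≤ ψ g)
  relGF⇒wd≤ (gex xs γ ψ) (guard (_ , _ , w) _ _ , h) = ⊔-lub w (relGF⇒wd≤ ψ h)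
  relGF⇒wd≤ (gall xs γ ψ) (guard (_ , _ , w) _ _ , h) = ⊔-lub w (relGF⇒wd≤ ψ h)

  ⟨⟩-atom : ∀ {S R} {ws : Vec ℕ n} → n ≤ b → toList ws ⊆ S → RelGF b S (atom (R ⟨ ws ⟩))
  ⟨⟩-atom {R = R} {ws} n≤b ws⊆S = relAtom (noConst-vars ws , tt , n≤b) (subst (_⊆ _) (sym (avars-⟨⟩ R ws)) ws⊆S)

  ⟨⟩-guarded : ∀ {S xs R ψ} {ws : Vec ℕ n} → n ≤ b → xs ⊆ toList ws → toList ws ⊆ xs ++ S →
               RelGF b (toList ws) ψ → Guard b S xs (R ⟨ ws ⟩) × RelGF b (avars (R ⟨ ws ⟩)) ψ
  ⟨⟩-guarded {S = S} {xs} {R} {ψ} {ws} n≤b xs⊆ ws⊆ h =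
    guard (noConst-vars ws , tt , n≤b) (subst (xs ⊆_) vars≡ xs⊆) (subst (_⊆ xs ++ S) vars≡ ws⊆) ,
    subst (λ V → RelGF b V ψ) vars≡ h
    where vars≡ = sym (avars-⟨⟩ R ws)

  ⟨⟩-binding : ∀ {S xs R ψ} {ws : Vec ℕ n} → n ≤ b → toList ws ≡ xs →
               RelGF b (toList ws) ψ → Guard b S xs (R ⟨ ws ⟩) × RelGF b (avars (R ⟨ ws ⟩)) ψ
  ⟨⟩-binding {xs = xs} {ψ = ψ} n≤b ws≡xs =
    ⟨⟩-guarded {ψ = ψ} n≤b (⊆-reflexive (sym ws≡xs)) (⊆-trans (⊆-reflexive ws≡xs) (xs⊆xs++ys xs _))

-- The sentence

-- ARR x z̄: x holds the tuple z̄;  NEXT x y z̄: y is a successor of x at z̄;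
-- BIT x z̄: the bit of x at z̄;  BEFORE x y a b: a precedes b in the order of the successor y.
pattern ARR = 0
pattern NEXT = 1
pattern BIT = 2
pattern BEFORE = 3

-- The variables are x = 0, y = 1 and the tuple z̄ = 2, 3, …, k + 4 of length k + 3.
module Construction (k : ℕ) where

  rest : List ℕ
  rest = List.applyUpTo (5 +_) k

  zs : List ℕ
  zs = 2 ∷ 3 ∷ 4 ∷ rest

  L : ℕ
  L = length zs

  z̄ : Vec ℕ L
  z̄ = Vec.fromList zs

  iff : Fm → Fm → Fm
  iff φ ψ = and (imp φ ψ) (imp ψ φ)

  beforeAtom : ℕ → ℕ → Fm
  beforeAtom a b = atom (BEFORE ⟨ 0 ∷ 1 ∷ a ∷ b ∷ [] ⟩)

  chainFrom : ℕ → ℕ → List ℕ → Fm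
  chainFrom a b [] = beforeAtom a b
  chainFrom a b (c ∷ l) = and (beforeAtom a b) (chainFrom b c l)

  chain : Fm
  chain = chainFrom 2 3 (4 ∷ rest)

  bitAtom : ℕ → Fm
  bitAtom u = atom (BIT ⟨ u ∷ z̄ ⟩)

  arrBody : Fm
  arrBody =
    and (atom (ARR ⟨ 0 ∷ swap₀₁ z̄ ⟩))
    (and (atom (ARR ⟨ 0 ∷ rotate z̄ ⟩))
         (gex (1 ∷ []) (NEXT ⟨ 0 ∷ 1 ∷ z̄ ⟩) chain))

  nextBody : Fm
  nextBody =
    and (atom (NEXT ⟨ 0 ∷ 1 ∷ swap₀₁ z̄ ⟩))
    (and (atom (NEXT ⟨ 0 ∷ 1 ∷ rotate z̄ ⟩))
    (and (atom (ARR ⟨ 1 ∷ z̄ ⟩))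
    (and (neg (and (beforeAtom 2 3) (beforeAtom 3 2)))
    (and (imp (and (beforeAtom 2 3) (beforeAtom 3 4)) (beforeAtom 2 4))
         (and (imp chain (iff (bitAtom 1) (neg (bitAtom 0))))
              (imp (neg chain) (iff (bitAtom 1) (bitAtom 0))))))))

  startAxiom : Fm
  startAxiom = gex (0 ∷ zs) (ARR ⟨ 0 ∷ z̄ ⟩) (atom (ARR ⟨ 0 ∷ z̄ ⟩))

  arrAxiom : Fm
  arrAxiom = gall (0 ∷ zs) (ARR ⟨ 0 ∷ z̄ ⟩) arrBody

  nextAxiom : Fm
  nextAxiom = gall (0 ∷ 1 ∷ zs) (NEXT ⟨ 0 ∷ 1 ∷ z̄ ⟩) nextBody

  φ : Fm
  φ = and startAxiom (and arrAxiom nextAxiom)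

  len-chainFrom : ∀ a b l → len (chainFrom a b l) ≡ 5 + length l * 6
  len-chainFrom a b [] = refl
  len-chainFrom a b (c ∷ l) = cong (6 +_) (len-chainFrom b c l)

  len-φ : len φ ≡ 199 + 39 * k
  -- Normalisation unfolds two of the three copies of chain by one step, hence two rewrites.
  len-φ rewrite len-chainFrom 2 3 (4 ∷ rest) | len-chainFrom 3 4 rest | length-applyUpTo (5 +_) k =
    solve [ k ]

  width : ℕ
  width = 2 + L

  private
    Z : List ℕ
    Z = toList z̄

    Z≡zs : Z ≡ zs
    Z≡zs = toList∘fromList zs

    4≤width : 4 ≤ width
    4≤width = s≤s (s≤s (s≤s (s≤s z≤n)))

    L+1≤width : suc L ≤ width
    L+1≤width = n≤1+n _

    beforeAtom-relGF : ∀ {a b} → a ∈ Z → b ∈ Z → RelGF width (0 ∷ 1 ∷ Z) (beforeAtom a b)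
    beforeAtom-relGF a∈ b∈ = ⟨⟩-atom 4≤width
      (∈-∷⁺ʳ (here refl) (∈-∷⁺ʳ (there (here refl))
        (∈-∷⁺ʳ (there (there a∈)) (∈-∷⁺ʳ (there (there b∈)) λ ()))))

    chainFrom-relGF : ∀ a b l → a ∷ b ∷ l ⊆ Z → RelGF width (0 ∷ 1 ∷ Z) (chainFrom a b l)
    chainFrom-relGF a b [] ab⊆ = beforeAtom-relGF (ab⊆ (here refl)) (ab⊆ (there (here refl)))
    chainFrom-relGF a b (c ∷ l) abl⊆ =
      beforeAtom-relGF (abl⊆ (here refl)) (abl⊆ (there (here refl))) ,
      chainFrom-relGF b c l (⊆-trans (xs⊆x∷xs _ a) abl⊆)

    chain-relGF : RelGF width (0 ∷ 1 ∷ Z) chain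
    chain-relGF = chainFrom-relGF 2 3 (4 ∷ rest) (⊆-reflexive (sym Z≡zs))

    2∈Z : 2 ∈ Z
    2∈Z = here refl

    3∈Z : 3 ∈ Z
    3∈Z = there (here refl)

    4∈Z : 4 ∈ Z
    4∈Z = there (there (here refl))

    bit₀ : RelGF width (0 ∷ 1 ∷ Z) (bitAtom 0)
    bit₀ = ⟨⟩-atom L+1≤width (∷⁺ʳ 0 (xs⊆x∷xs Z 1))

    bit₁ : RelGF width (0 ∷ 1 ∷ Z) (bitAtom 1)
    bit₁ = ⟨⟩-atom L+1≤width (xs⊆x∷xs _ 0)

    arrBody-relGF : RelGF width (0 ∷ Z) arrBody
    arrBody-relGF =
      ⟨⟩-atom L+1≤width (∷⁺ʳ 0 (⊆-reflexive-↭ (toList-swap₀₁-↭ z̄))) ,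
      ⟨⟩-atom L+1≤width (∷⁺ʳ 0 (⊆-reflexive-↭ (toList-rotate-↭ z̄))) ,
      ⟨⟩-guarded {ψ = chain} ≤-refl (∈-∷⁺ʳ (there (here refl)) λ ()) (⊆-reflexive-↭ (swap 0 1 ↭-refl))
        chain-relGF

    nextBody-relGF : RelGF width (0 ∷ 1 ∷ Z) nextBody
    nextBody-relGF =
      ⟨⟩-atom ≤-refl (∷⁺ʳ 0 (∷⁺ʳ 1 (⊆-reflexive-↭ (toList-swap₀₁-↭ z̄)))) ,
      ⟨⟩-atom ≤-refl (∷⁺ʳ 0 (∷⁺ʳ 1 (⊆-reflexive-↭ (toList-rotate-↭ z̄)))) ,
      ⟨⟩-atom L+1≤width (xs⊆x∷xs _ 0) ,
      (beforeAtom-relGF 2∈Z 3∈Z , beforeAtom-relGF 3∈Z 2∈Z) ,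
      ((beforeAtom-relGF 2∈Z 3∈Z , beforeAtom-relGF 3∈Z 4∈Z) , beforeAtom-relGF 2∈Z 4∈Z) ,
      (chain-relGF , (bit₁ , bit₀) , (bit₀ , bit₁)) , (chain-relGF , (bit₁ , bit₀) , (bit₀ , bit₁))

  φ-relGF : RelGF width [] φ
  φ-relGF =
    ⟨⟩-binding {ψ = atom (ARR ⟨ 0 ∷ z̄ ⟩)} L+1≤width (cong (0 ∷_) Z≡zs) (⟨⟩-atom L+1≤width id) ,
    ⟨⟩-binding {ψ = arrBody} L+1≤width (cong (0 ∷_) Z≡zs) arrBody-relGF ,
    ⟨⟩-binding {ψ = nextBody} ≤-refl (cong (λ l → 0 ∷ 1 ∷ l) Z≡zs) nextBody-relGF

  wd-φ : wd φ ≡ 2 + L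
  wd-φ = ≤-antisym (relGF⇒wd≤ φ φ-relGF)
    (≤-trans (m≤m⊔n (2 + L) (wd nextBody))
      (≤-trans (m≤n⊔m (wd arrAxiom) (wd nextAxiom)) (m≤n⊔m (wd startAxiom) _)))

-- Reading the sentence in a structure

module _ {D : Set} (M : Structure D) where

  evalTs-vars : ∀ ρ (ws : Vec ℕ n) → evalTs M ρ (Vec.map var ws) ≡ Vec.map ρ ws
  evalTs-vars ρ [] = refl
  evalTs-vars ρ (w ∷ ws) = cong (ρ w ∷_) (evalTs-vars ρ ws)

  satA-⟨⟩ : ∀ ρ R (ws : Vec ℕ n) → SatA M ρ (R ⟨ ws ⟩) ⇔ T (relI M R n (Vec.map ρ ws))
  satA-⟨⟩ ρ R ws = ≡⇒⇔ (cong (T ∘ relI M R _) (evalTs-vars ρ ws))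

  update-≡ : ∀ ρ x a → update M ρ x a x ≡ a
  update-≡ ρ x a with x ≟ x
  ... | yes _ = refl
  ... | no x≢x = ⊥-elim (x≢x refl)

  update-≢ : ∀ ρ {x} a {y} → y ≢ x → update M ρ x a y ≡ ρ y
  update-≢ ρ {x} a {y} y≢x with y ≟ x
  ... | yes y≡x = ⊥-elim (y≢x y≡x)
  ... | no _ = refl

  extend-∉ : ∀ ρ xs as {y} → y ∉ xs → extend M ρ xs as y ≡ ρ y
  extend-∉ ρ [] [] _ = refl
  extend-∉ ρ (x ∷ xs) (a ∷ as) y∉ =
    trans (extend-∉ (update M ρ x a) xs as (y∉ ∘ there)) (update-≢ ρ a (y∉ ∘ here))

  extend-fromList : ∀ ρ {xs} → Unique xs → (as : Vec D (length xs)) →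
                    Vec.map (extend M ρ xs as) (Vec.fromList xs) ≡ as
  extend-fromList ρ {[]} [] [] = refl
  extend-fromList ρ {x ∷ xs} (x≢xs ∷ unique) (a ∷ as) =
    cong₂ _∷_ (trans (extend-∉ (update M ρ x a) xs as (All¬⇒¬Any x≢xs)) (update-≡ ρ x a))
              (extend-fromList (update M ρ x a) unique as)

  map-update-∉ : ∀ ρ {x} a {xs} → x ∉ xs →
                 Vec.map (update M ρ x a) (Vec.fromList xs) ≡ Vec.map ρ (Vec.fromList xs)
  map-update-∉ ρ a {[]} _ = refl
  map-update-∉ ρ a {w ∷ xs} x∉ = cong₂ _∷_ (update-≢ ρ a (x∉ ∘ here ∘ sym)) (map-update-∉ ρ a (x∉ ∘ there))

  satA-extend : ∀ ρ R {xs} → Unique xs → (as : Vec D (length xs)) →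
                SatA M (extend M ρ xs as) (R ⟨ Vec.fromList xs ⟩) ⇔ T (relI M R _ as)
  satA-extend ρ R {xs} unique as = ⇔-trans (satA-⟨⟩ _ R (Vec.fromList xs))
    (≡⇒⇔ (cong (T ∘ relI M R _) (extend-fromList ρ unique as)))

module Reading {D : Set} (M : Structure D) (j : ℕ) where

  Tuple : Set
  Tuple = Vec D (3 + j)

  Arr : D → Tuple → Set
  Arr d v = T (relI M ARR (4 + j) (d ∷ v))

  Next : D → D → Tuple → Set
  Next d d′ v = T (relI M NEXT (5 + j) (d ∷ d′ ∷ v))

  bit : D → Tuple → Bool
  bit d v = relI M BIT (4 + j) (d ∷ v)

  Before : D → D → D → D → Set
  Before d d′ a b = T (relI M BEFORE 4 (d ∷ d′ ∷ a ∷ b ∷ []))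

  Chain : D → D → Tuple → Set
  Chain d d′ v = Linked (Before d d′) (toList v)

  record ArrFacts (d : D) (v : Tuple) : Set where
    field
      arr-swap : Arr d (swap₀₁ v)
      arr-rotate : Arr d (rotate v)
      successor : ∃[ d′ ] Next d d′ v × Chain d d′ v

  entry₀ entry₁ entry₂ : Tuple → D
  entry₀ v = Vec.lookup v zero
  entry₁ v = Vec.lookup v (suc zero)
  entry₂ v = Vec.lookup v (suc (suc zero))

  record NextFacts (d d′ : D) (v : Tuple) : Set where
    field
      next-swap : Next d d′ (swap₀₁ v)
      next-rotate : Next d d′ (rotate v)
      next-arr : Arr d′ v
      asym : ¬ (Before d d′ (entry₀ v) (entry₁ v) × Before d d′ (entry₁ v) (entry₀ v))
      trans₀₁₂ : Before d d′ (entry₀ v) (entry₁ v) → Before d d′ (entry₁ v) (entry₂ v) →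
                 Before d d′ (entry₀ v) (entry₂ v)
      flip : Chain d d′ v → bit d′ v ≡ not (bit d v)
      keep : ¬ Chain d d′ v → bit d′ v ≡ bit d v

  record Axioms : Set where
    field
      start : ∃[ d ] ∃[ v ] Arr d v
      arr : ∀ {d v} → Arr d v → ArrFacts d v
      next : ∀ {d d′ v} → Next d d′ v → NextFacts d d′ v

module _ {D : Set} (M : Structure D) (k : ℕ) where
  open Construction k
  open Reading M (length rest)
  open Equivalence using (to; from)

  private
    unique₀₁ : Unique (0 ∷ 1 ∷ zs)
    unique₀₁ = upTo⁺ (5 + k)

    unique₀ : Unique (0 ∷ zs)
    unique₀ with 0≢1∷zs ∷ _ ∷ unique ← unique₀₁ = All.tail 0≢1∷zs ∷ unique

    1∉zs : 1 ∉ zs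
    1∉zs with _ ∷ 1≢zs ∷ _ ← unique₀₁ = All¬⇒¬Any 1≢zs

    arr⟨⟩ : ∀ env u {ws w} → Vec.map env ws ≡ w → SatA M env (ARR ⟨ u ∷ ws ⟩) ⇔ Arr (env u) w
    arr⟨⟩ env u {ws} e = ⇔-trans (satA-⟨⟩ M env ARR (u ∷ ws)) (≡⇒⇔ (cong (Arr (env u)) e))

    next⟨⟩ : ∀ env {ws w} → Vec.map env ws ≡ w → SatA M env (NEXT ⟨ 0 ∷ 1 ∷ ws ⟩) ⇔ Next (env 0) (env 1) w
    next⟨⟩ env {ws} e = ⇔-trans (satA-⟨⟩ M env NEXT (0 ∷ 1 ∷ ws)) (≡⇒⇔ (cong (Next (env 0) (env 1)) e))

    bit⟨⟩ : ∀ env u → relI M BIT _ (evalTs M env (Vec.map var (u ∷ z̄))) ≡ bit (env u) (Vec.map env z̄)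
    bit⟨⟩ env u = cong (relI M BIT _) (evalTs-vars M env (u ∷ z̄))

  sat-chainFrom : ∀ env a b l → Sat M env (chainFrom a b l) ⇔
                  Linked (Before (env 0) (env 1)) (toList (Vec.map env (Vec.fromList (a ∷ b ∷ l))))
  sat-chainFrom env a b [] = mk⇔ (_∷ [-]) λ { (a≺b ∷ [-]) → a≺b }
  sat-chainFrom env a b (c ∷ l) =
    mk⇔ (λ (a≺b , links) → a≺b ∷ to (sat-chainFrom env b c l) links)
        (λ { (a≺b ∷ links) → a≺b , from (sat-chainFrom env b c l) links })

  sat-chain : ∀ env → Sat M env chain ⇔ Chain (env 0) (env 1) (Vec.map env z̄)
  sat-chain env = sat-chainFrom env 2 3 (4 ∷ rest)

  sat-arrBody : ∀ env → Sat M env arrBody ⇔ ArrFacts (env 0) (Vec.map env z̄)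
  sat-arrBody env = mk⇔ reading writing
    where
    module _ (d′ : D) where
      env′ : ℕ → D
      env′ = update M env 1 d′

      z̄-unchanged : Vec.map env′ z̄ ≡ Vec.map env z̄
      z̄-unchanged = map-update-∉ M env d′ {zs} 1∉zs

    reading : Sat M env arrBody → ArrFacts (env 0) (Vec.map env z̄)
    reading (s , r , (d′ ∷ [] , n , c)) = record
      { arr-swap = to (arr⟨⟩ env 0 (map-swap₀₁ env z̄)) s
      ; arr-rotate = to (arr⟨⟩ env 0 (map-rotate env z̄)) r
      ; successor = d′ , to (next⟨⟩ (env′ d′) {z̄} (z̄-unchanged d′)) n
                       , subst (Chain (env 0) d′) (z̄-unchanged d′) (to (sat-chain (env′ d′)) c)
      }

    writing : ArrFacts (env 0) (Vec.map env z̄) → Sat M env arrBody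
    writing record { arr-swap = s ; arr-rotate = r ; successor = d′ , n , c } =
      from (arr⟨⟩ env 0 (map-swap₀₁ env z̄)) s ,
      from (arr⟨⟩ env 0 (map-rotate env z̄)) r ,
      (d′ ∷ [] , from (next⟨⟩ (env′ d′) {z̄} (z̄-unchanged d′)) n
               , from (sat-chain (env′ d′)) (subst (Chain (env 0) d′) (sym (z̄-unchanged d′)) c))

  sat-nextBody : ∀ env → Sat M env nextBody ⇔ NextFacts (env 0) (env 1) (Vec.map env z̄)
  sat-nextBody env = mk⇔ reading writing
    where
    b₀ b₁ : Bool
    b₀ = relI M BIT _ (evalTs M env (Vec.map var (0 ∷ z̄)))
    b₁ = relI M BIT _ (evalTs M env (Vec.map var (1 ∷ z̄)))

    flip⇔ : b₁ ≡ not b₀ ⇔ (bit (env 1) (Vec.map env z̄) ≡ not (bit (env 0) (Vec.map env z̄)))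
    flip⇔ = ≡⇒⇔ (cong₂ (λ x y → x ≡ not y) (bit⟨⟩ env 1) (bit⟨⟩ env 0))

    keep⇔ : b₁ ≡ b₀ ⇔ (bit (env 1) (Vec.map env z̄) ≡ bit (env 0) (Vec.map env z̄))
    keep⇔ = ≡⇒⇔ (cong₂ _≡_ (bit⟨⟩ env 1) (bit⟨⟩ env 0))

    reading : Sat M env nextBody → NextFacts (env 0) (env 1) (Vec.map env z̄)
    reading (s , r , a , asym , trans₀₁₂ , fl , kp) = record
      { next-swap = to (next⟨⟩ env (map-swap₀₁ env z̄)) s
      ; next-rotate = to (next⟨⟩ env (map-rotate env z̄)) r
      ; next-arr = to (arr⟨⟩ env 1 refl) a
      ; asym = asym
      ; trans₀₁₂ = λ p q → trans₀₁₂ (p , q)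
      ; flip = λ c → to flip⇔ (from ≡not⇔ (fl (from (sat-chain env) c)))
      ; keep = λ ¬c → to keep⇔ (from ≡⇔ (kp (¬c ∘ to (sat-chain env))))
      }

    writing : NextFacts (env 0) (env 1) (Vec.map env z̄) → Sat M env nextBody
    writing facts =
      from (next⟨⟩ env (map-swap₀₁ env z̄)) next-swap ,
      from (next⟨⟩ env (map-rotate env z̄)) next-rotate ,
      from (arr⟨⟩ env 1 refl) next-arr ,
      asym ,
      (λ (p , q) → trans₀₁₂ p q) ,
      (λ c → to ≡not⇔ (from flip⇔ (flip (to (sat-chain env) c)))) ,
      (λ ¬c → to ≡⇔ (from keep⇔ (keep (¬c ∘ from (sat-chain env)))))
      where open NextFacts facts

  sat-startAxiom : ∀ ρ → Sat M ρ startAxiom ⇔ (∃[ d ] ∃[ v ] Arr d v)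
  sat-startAxiom ρ = mk⇔
    (λ { (d ∷ v , held , _) → d , v , to (satA-extend M ρ ARR unique₀ (d ∷ v)) held })
    (λ (d , v , a) → d ∷ v , from (satA-extend M ρ ARR unique₀ (d ∷ v)) a
                           , from (satA-extend M ρ ARR unique₀ (d ∷ v)) a)

  sat-arrAxiom : ∀ ρ → Sat M ρ arrAxiom ⇔ (∀ {d v} → Arr d v → ArrFacts d v)
  sat-arrAxiom ρ = mk⇔ reading writing
    where
    reads : ∀ d v → let env = extend M ρ (0 ∷ zs) (d ∷ v) in env 0 ≡ d × Vec.map env z̄ ≡ v
    reads d v = ∷-injective (extend-fromList M ρ unique₀ (d ∷ v))

    reading : Sat M ρ arrAxiom → ∀ {d v} → Arr d v → ArrFacts d v
    reading arrs {d} {v} a with e₀ , eᵥ ← reads d v =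
      subst₂ ArrFacts e₀ eᵥ (to (sat-arrBody _) (arrs (d ∷ v) (from (satA-extend M ρ ARR unique₀ (d ∷ v)) a)))

    writing : (∀ {d v} → Arr d v → ArrFacts d v) → Sat M ρ arrAxiom
    writing arr (d ∷ v) held with e₀ , eᵥ ← reads d v =
      from (sat-arrBody _) (subst₂ ArrFacts (sym e₀) (sym eᵥ) (arr (to (satA-extend M ρ ARR unique₀ (d ∷ v)) held)))

  sat-nextAxiom : ∀ ρ → Sat M ρ nextAxiom ⇔ (∀ {d d′ v} → Next d d′ v → NextFacts d d′ v)
  sat-nextAxiom ρ = mk⇔ reading writing
    where
    reads : ∀ d d′ v → let env = extend M ρ (0 ∷ 1 ∷ zs) (d ∷ d′ ∷ v) in
            (env 0 , env 1) ≡ (d , d′) × Vec.map env z̄ ≡ v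
    reads d d′ v with e₀ , e ← ∷-injective (extend-fromList M ρ unique₀₁ (d ∷ d′ ∷ v))
                 with e₁ , eᵥ ← ∷-injective e = cong₂ _,_ e₀ e₁ , eᵥ

    NextFacts′ : D × D → Tuple → Set
    NextFacts′ (d , d′) = NextFacts d d′

    reading : Sat M ρ nextAxiom → ∀ {d d′ v} → Next d d′ v → NextFacts d d′ v
    reading nexts {d} {d′} {v} n with e₀₁ , eᵥ ← reads d d′ v =
      subst₂ NextFacts′ e₀₁ eᵥ
        (to (sat-nextBody _) (nexts (d ∷ d′ ∷ v) (from (satA-extend M ρ NEXT unique₀₁ (d ∷ d′ ∷ v)) n)))

    writing : (∀ {d d′ v} → Next d d′ v → NextFacts d d′ v) → Sat M ρ nextAxiom
    writing next (d ∷ d′ ∷ v) held with e₀₁ , eᵥ ← reads d d′ v =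
      from (sat-nextBody _)
        (subst₂ NextFacts′ (sym e₀₁) (sym eᵥ) (next (to (satA-extend M ρ NEXT unique₀₁ (d ∷ d′ ∷ v)) held)))

  sat-φ : ∀ ρ → Sat M ρ φ ⇔ Axioms
  sat-φ ρ = mk⇔
    (λ (s , a , n) → record
      { start = to (sat-startAxiom ρ) s ; arr = to (sat-arrAxiom ρ) a ; next = to (sat-nextAxiom ρ) n })
    (λ axioms → let open Axioms axioms in
      from (sat-startAxiom ρ) start , from (sat-arrAxiom ρ) arr , from (sat-nextAxiom ρ) next)

-- Large models

module LowerBound {D : Set} {M : Structure D} {j : ℕ} (axioms : Reading.Axioms M j) where
  open Reading M j
  open Axioms axioms

  private
    x̄ : Tuple
    x̄ = proj₁ (proj₂ start)

    X : List D
    X = toList x̄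

    Good : D → Set
    Good d = Arr d x̄

    arr-↭ : ∀ {d u w} → Arr d u → toList u ↭ toList w → Arr d w
    arr-↭ {d} = resp-↭ (Arr d) (ArrFacts.arr-swap ∘ arr) (ArrFacts.arr-rotate ∘ arr)

    next-↭ : ∀ {d d′ u w} → Next d d′ u → toList u ↭ toList w → Next d d′ w
    next-↭ {d} {d′} = resp-↭ (Next d d′) (NextFacts.next-swap ∘ next) (NextFacts.next-rotate ∘ next)

    next-realise : ∀ {d d′ u l} → Next d d′ u → toList u ↭ l → ∃[ v ] toList v ≡ l × Next d d′ v
    next-realise {d} {d′} = realise-↭ (Next d d′) (NextFacts.next-swap ∘ next) (NextFacts.next-rotate ∘ next)

    module Successor {d : D} (good : Good d) {u : Tuple} (u↭X : toList u ↭ X) where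

      successor : ∃[ d′ ] Next d d′ u × Chain d d′ u
      successor = ArrFacts.successor (arr (arr-↭ good (↭-sym u↭X)))

      d′ : D
      d′ = proj₁ successor

      next-u : Next d d′ u
      next-u = proj₁ (proj₂ successor)

      chain-u : Chain d d′ u
      chain-u = proj₂ (proj₂ successor)

      next-X : ∀ {w} → toList w ↭ X → NextFacts d d′ w
      next-X w↭X = next (next-↭ next-u (↭-trans u↭X (↭-sym w↭X)))

      good′ : Good d′
      good′ = NextFacts.next-arr (next-X ↭-refl)

      asymmetricOn : AsymmetricOn (Before d d′) X
      asymmetricOn p with _ ∷ _ ∷ _ , refl , n ← next-realise next-u (↭-trans u↭X (↭-sym p)) =
        NextFacts.asym (next n)

      transitiveOn : TransitiveOn (Before d d′) X
      transitiveOn p with _ ∷ _ ∷ _ ∷ _ , refl , n ← next-realise next-u (↭-trans u↭X (↭-sym p)) =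
        NextFacts.trans₀₁₂ (next n)

      sorted : ∀ {w} → toList w ↭ X → Chain d d′ w → AllPairs (Before d d′) (toList w)
      sorted w↭X = linked⇒allPairs (Before d d′) (λ p → transitiveOn (↭-trans p w↭X))

      chain-unique : ∀ {w} → toList w ↭ X → Chain d d′ w → w ≡ u
      chain-unique w↭X chain-w = toList-injective′
        (allPairs-↭⇒≡ (Before d d′) (λ p → asymmetricOn (↭-trans p w↭X)) (↭-trans w↭X (↭-sym u↭X))
          (sorted w↭X chain-w) (sorted u↭X chain-u))

    unique-X : Unique X
    unique-X = allPairs⇒unique (Before _ d′) asymmetricOn (sorted ↭-refl chain-u)
      where open Successor (proj₂ (proj₂ start)) {x̄} ↭-refl

    arrangement : Fin ((3 + j) !) → Tuple
    arrangement = arrangements x̄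

    arrangement-↭ : ∀ c → toList (arrangement c) ↭ X
    arrangement-↭ = arrangements-↭ x̄

    profile : D → Fin ((3 + j) !) → Bool
    profile d c = bit d (arrangement c)

    flipsEachBit : FlipsEachBit profile Good
    flipsEachBit {d} good c = d′ , good′ , NextFacts.flip (next-X (arrangement-↭ c)) chain-u , kept
      where
      open Successor good (arrangement-↭ c)
      kept : ∀ {c′} → c′ ≢ c → profile d′ c′ ≡ profile d c′
      kept {c′} c′≢c = NextFacts.keep (next-X (arrangement-↭ c′)) λ chain →
        c′≢c (arrangements-injective x̄ unique-X (chain-unique (arrangement-↭ c′) chain))

  embedding : Fin (2 ^ ((3 + j) !)) ↣ D
  embedding = profiles-↣ profile Good flipsEachBit (proj₂ (proj₂ start))

-- A model

-- A node records how it arose from the root by toggles; toggle d w has the bits of d,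
-- flipped at the arrangements that w lists in increasing order.
data Node : Set where
  root : Node
  toggle : Node → List Node → Node

toggle-injective : ∀ {d d′ w w′} → toggle d w ≡ toggle d′ w′ → d ≡ d′ × w ≡ w′
toggle-injective refl = refl , refl

infix 4 _≟ₙ_ _≟ₗ_
_≟ₙ_ : DecidableEquality Node
_≟ₗ_ : DecidableEquality (List Node)
root ≟ₙ root = yes refl
root ≟ₙ toggle _ _ = no λ ()
toggle _ _ ≟ₙ root = no λ ()
toggle d w ≟ₙ toggle d′ w′ =
  map′ (λ (d≡d′ , w≡w′) → cong₂ toggle d≡d′ w≡w′) toggle-injective (d ≟ₙ d′ ×-dec w ≟ₗ w′)
[] ≟ₗ [] = yes refl
[] ≟ₗ _ ∷ _ = no λ ()
_ ∷ _ ≟ₗ [] = no λ ()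
a ∷ w ≟ₗ b ∷ w′ = map′ (λ (a≡b , w≡w′) → cong₂ _∷_ a≡b w≡w′) ∷-injectiveˡ (a ≟ₙ b ×-dec w ≟ₗ w′)

position : List Node → Node → ℕ
position [] a = 0
position (b ∷ w) a with b ≟ₙ a
... | yes _ = 0
... | no _ = suc (position w a)

position-head : ∀ a w → position (a ∷ w) a ≡ 0
position-head a w with a ≟ₙ a
... | yes _ = refl
... | no a≢a = ⊥-elim (a≢a refl)

position-∷ : ∀ {a b} w → a ≢ b → position (a ∷ w) b ≡ suc (position w b)
position-∷ {a} {b} w a≢b with a ≟ₙ b
... | yes a≡b = ⊥-elim (a≢b a≡b)
... | no _ = refl

_≺[_]_ : Node → List Node → Node → Set
a ≺[ w ] b = T (position w a <ᵇ position w b)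

_≺[_]?_ : ∀ a w b → Dec (a ≺[ w ] b)
a ≺[ w ]? b = T? (position w a <ᵇ position w b)

≺-asym : ∀ {w a b} → ¬ (a ≺[ w ] b × b ≺[ w ] a)
≺-asym {w} {a} {b} (a≺b , b≺a) = <-asym (<ᵇ⇒< (position w a) _ a≺b) (<ᵇ⇒< (position w b) _ b≺a)

≺-trans : ∀ {w a b c} → a ≺[ w ] b → b ≺[ w ] c → a ≺[ w ] c
≺-trans {w} {a} {b} {c} a≺b b≺c =
  <⇒<ᵇ (<-trans (<ᵇ⇒< (position w a) (position w b) a≺b) (<ᵇ⇒< (position w b) (position w c) b≺c))

≺-self : ∀ {u} → Unique u → Linked (_≺[ u ]_) u
≺-self [] = []
≺-self (_ ∷ []) = [-]
≺-self {a ∷ b ∷ l} ((a≢b All.∷ a≢l) ∷ unique) =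
  positions (position-head a (b ∷ l)) (position-∷ (b ∷ l) a≢b) tt ∷
  behind-a (a≢b All.∷ a≢l) (≺-self unique)
  where
  positions : ∀ {w x y p q} → position w x ≡ p → position w y ≡ q → T (p <ᵇ q) → x ≺[ w ] y
  positions e e′ = subst₂ (λ p q → T (p <ᵇ q)) (sym e) (sym e′)

  behind-a : ∀ {l′} → All (a ≢_) l′ → Linked (_≺[ b ∷ l ]_) l′ → Linked (_≺[ a ∷ b ∷ l ]_) l′
  behind-a _ [] = []
  behind-a _ [-] = [-]
  behind-a (a≢x All.∷ a≢y All.∷ a≢l′) (x≺y ∷ linked) =
    positions (position-∷ (b ∷ l) a≢x) (position-∷ (b ∷ l) a≢y) x≺y ∷ behind-a (a≢y All.∷ a≢l′) linked

ordered : List Node → List Node → Bool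
ordered w l = ⌊ linked? (_≺[ w ]?_) l ⌋

ordered-true : ∀ {w l} → Linked (_≺[ w ]_) l → ordered w l ≡ true
ordered-true {w} {l} c = trans (isYes≗does (linked? (_≺[ w ]?_) l)) (dec-true (linked? (_≺[ w ]?_) l) c)

ordered-false : ∀ {w l} → ¬ Linked (_≺[ w ]_) l → ordered w l ≡ false
ordered-false {w} {l} ¬c = trans (isYes≗does (linked? (_≺[ w ]?_) l)) (dec-false (linked? (_≺[ w ]?_) l) ¬c)

flagged : Node → List Node → Bool
flagged root l = false
flagged (toggle d w) l = ordered w l xor flagged d l

distinct : Vec Node n → Bool
distinct v = ⌊ UniqueDec.unique? _≟ₙ_ (toList v) ⌋

interpret : (R k : ℕ) → Vec Node k → Bool
interpret ARR _ (_ ∷ v) = distinct v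
interpret NEXT _ (d ∷ toggle d′ _ ∷ v) = ⌊ d ≟ₙ d′ ⌋ ∧ distinct v
interpret BIT _ (d ∷ v) = flagged d (toList v)
interpret BEFORE _ (_ ∷ toggle _ w ∷ a ∷ b ∷ []) = position w a <ᵇ position w b
interpret _ _ _ = false

model : Structure Node
model = record { relI = interpret ; conI = λ _ → root }

distinctNodes : ∀ n → Vec Node n
distinctNodes zero = []
distinctNodes (suc n) = root ∷ Vec.map (λ d → toggle d []) (distinctNodes n)

distinctNodes-unique : ∀ n → Unique (toList (distinctNodes n))
distinctNodes-unique zero = []
distinctNodes-unique (suc n) rewrite toList-map (λ d → toggle d []) (distinctNodes n) =
  All-map⁺ (All.universal (λ _ ()) _) ∷ Unique-map⁺ (proj₁ ∘ toggle-injective) (distinctNodes-unique n)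

model-axioms : ∀ j → Reading.Axioms model j
model-axioms j = record
  { start = root , distinctNodes (3 + j) , fromWitness (distinctNodes-unique (3 + j))
  ; arr = arrFacts
  ; next = nextFacts
  }
  where
  open Reading model j

  distinct-↭ : ∀ {u w : Tuple} → toList u ↭ toList w → T (distinct u) → T (distinct w)
  distinct-↭ u↭w = fromWitness ∘ unique-↭ u↭w ∘ toWitness

  arrFacts : ∀ {d v} → Arr d v → ArrFacts d v
  arrFacts {d} {v} a = record
    { arr-swap = distinct-↭ (↭-sym (toList-swap₀₁-↭ v)) a
    ; arr-rotate = distinct-↭ (↭-sym (toList-rotate-↭ v)) a
    ; successor = toggle d (toList v) , Equivalence.from T-∧ (fromWitness refl , a) , ≺-self (toWitness a)
    }

  nextFacts : ∀ {d d′ v} → Next d d′ v → NextFacts d d′ v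
  nextFacts {d} {toggle d′ w} {v} n
    with same , a ← Equivalence.to T-∧ n
    with refl ← toWitness {a? = d ≟ₙ d′} same = record
    { next-swap = Equivalence.from T-∧ (same , distinct-↭ (↭-sym (toList-swap₀₁-↭ v)) a)
    ; next-rotate = Equivalence.from T-∧ (same , distinct-↭ (↭-sym (toList-rotate-↭ v)) a)
    ; next-arr = a
    ; asym = ≺-asym {w}
    ; trans₀₁₂ = ≺-trans {w}
    ; flip = λ c → cong (_xor flagged d (toList v)) (ordered-true {w} c)
    ; keep = λ ¬c → cong (_xor flagged d (toList v)) (ordered-false {w} ¬c)
    }

module _ (k : ℕ) where
  open Construction k

  length-rest : length rest ≡ k
  length-rest = length-applyUpTo (5 +_) k

  wd-sentence : wd φ ≡ suc k + 4
  wd-sentence = trans wd-φ (trans (cong (5 +_) length-rest) (cong suc (+-comm 4 k)))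

  satisfiable : Satisfiable φ
  satisfiable =
    Node , model , root , Equivalence.from (sat-φ model k (λ _ → root)) (model-axioms (length rest))

  models-↣ : ∀ {D} (M : Structure D) ρ → Sat M ρ φ → Fin (2 ^ ((3 + k) !)) ↣ D
  models-↣ M ρ sat = subst (λ j → Fin (2 ^ ((3 + j) !)) ↣ _) length-rest
    (LowerBound.embedding (Equivalence.to (sat-φ M k ρ) sat))

  large-models : OnlyModelsOfSizeAtLeast (2 ^ (suc k !)) φ
  large-models m M ρ sat =
    ≤-trans (^-monoʳ-≤ 2 (≤-trans (n!≤[1+n]! (suc k)) (n!≤[1+n]! (2 + k)))) (↣⇒≤ (models-↣ M ρ sat))

sentence : ℕ → Fm
sentence n = Construction.φ (pred n)

proposition27 :
    Σ ℕ λ C → 0 < C × Σ (ℕ → Fm) λ φ → ∀ n → 1 ≤ n →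
      IsGF (φ n) × Sentence (φ n) × NoConst (φ n) × NoEq (φ n)
      × wd (φ n) ≡ n + 4 × len (φ n) ≤ C * n
      × Satisfiable (φ n) × OnlyModelsOfSizeAtLeast (2 ^ (n !)) (φ n)
proposition27 = 238 , s≤s z≤n , sentence , λ where
  (suc k) _ → let open Construction k in
      relGF⇒isGF φ φ-relGF , relGF⇒sentence φ φ-relGF
    , relGF⇒noConst φ φ-relGF , relGF⇒noEq φ φ-relGF
    , wd-sentence k
    , ≤-trans (≤-reflexive len-φ) (affine≤ 199 39 k)
    , satisfiable k
    , large-models k
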